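{- For every $m\ge 2$, the greedy procedure described below returns $G=R_m$.
   Context: Let $m\ge2$ and start with nested sets $S_0\subset S_1\subset\cdots\subset S_m$ with $\#S_i=i$ (e.g. $S_i=\{1,\ldots,i\}$). For $1\le i\le m-1$ let $S_i^*=S_{i-1}\cup(S_{i+1}\setminus S_i)$ denote the alteration of $S_i$ with respect to the current chain. Greedy procedure: set $G=[\ ]$, $\mathcal{S}=\{S_1,\ldots,S_m\}$, $J=\{1,\ldots,m-1\}$. While $J\neq\emptyset$: let $j=\max J$; append $j$ to $G$; replace $S_j$ by $S_j^*$; add the new $S_j$ to $\mathcal{S}$; set $J=\{i\in\{1,\ldots,m-1\}: S_i^*\notin\mathcal{S}\}$ (computed with the current chain). Return $G$. The sequences $R_m$ are defined by $R_2=[1]$ and $R_m=(R_{m-1}+1)\cup[1,2,\ldots,m-1]\cup R_{m-1}$ for $m\ge3$, where $\cup$ is concatenation and $R_{m-1}+1$ adds $1$ to each entry. -}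

module Defs where

open import Data.Nat using (ℕ; zero; suc; _+_; _∸_; _⊔_; _<ᵇ_; _≡ᵇ_)
open import Data.Bool using (Bool; true; false; if_then_else_)
import Data.Bool as B
open import Data.Fin using (Fin; toℕ)
open import Data.Fin.Subset using (Subset; _∪_; _─_)
open import Data.Vec using (tabulate)
import Data.Vec.Properties as VP
open import Data.List using (List; []; _∷_; _++_; map; filter; applyUpTo; foldr)
import Data.List.Membership.DecPropositional as Mem
open import Relation.Nullary using (¬?)
open import Relation.Binary.PropositionalEquality using (_≡_; _≢_)

-- Elements of the ground set {1,…,m} are represented by Fin m (element x ↦ toℕ x + 1).
-- A chain S₀ ⊂ S₁ ⊂ ⋯ ⊂ Sₘ is represented by a function ℕ → Subset m
-- (only indices 0..m are ever used).
Chain : ℕ → Set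
Chain m = ℕ → Subset m

initChain : (m : ℕ) → Chain m
initChain m i = tabulate (λ (x : Fin m) → toℕ x <ᵇ i)

alt : ∀ {m} → Chain m → ℕ → Subset m
alt S i = S (i ∸ 1) ∪ (S (suc i) ─ S i)

update : ∀ {m} → Chain m → ℕ → Subset m → Chain m
update S j X k = if k ≡ᵇ j then X else S k

from : ℕ → ℕ → List ℕ
from a n = applyUpTo (λ k → a + k) n

indices : ℕ → List ℕ
indices m = from 1 (m ∸ 1)

computeJ : (m : ℕ) → Chain m → List (Subset m) → List ℕ
computeJ m S 𝒮 = filter (λ i → ¬? (alt S i ∈? 𝒮)) (indices m)
  where open Mem {A = Subset m} (VP.≡-dec B._≟_) using (_∈?_)

-- Maximum of a list of naturals (used only on nonempty J).
maxList : List ℕ → ℕ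
maxList = foldr _⊔_ 0

-- Big-step semantics of the greedy loop:
-- GreedyRun m S 𝒮 J G  means: running the while-loop from the state (chain S,
-- collection 𝒮, current index set J) terminates, and the list of indices
-- appended to G during the run is exactly G.  (The loop is deterministic, so
-- this relation is functional in G.)
data GreedyRun (m : ℕ) : Chain m → List (Subset m) → List ℕ → List ℕ → Set where
  stop : ∀ {S 𝒮} → GreedyRun m S 𝒮 [] []
  step : ∀ {S 𝒮 J G} → J ≢ [] →
         let j  = maxList J
             S′ = update S j (alt S j)
             𝒮′ = 𝒮 ++ (S′ j ∷ [])
         in GreedyRun m S′ 𝒮′ (computeJ m S′ 𝒮′) G →
            GreedyRun m S 𝒮 J (j ∷ G)

GreedyReturns : ℕ → List ℕ → Set
GreedyReturns m G =
  GreedyRun m (initChain m) (map (initChain m) (from 1 m)) (indices m) G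

-- R₂ = [1],  Rₘ = (R_{m-1} + 1) ∪ [1,…,m-1] ∪ R_{m-1}.
-- (Values for m < 2 are irrelevant conventions.)
R : ℕ → List ℕ
R zero = []
R (suc zero) = []
R (suc (suc zero)) = 1 ∷ []
R (suc (suc (suc k))) =
  map suc (R (suc (suc k))) ++ indices (suc (suc (suc k))) ++ R (suc (suc k))

module Submission where

-- Call the chain saturated on a window [lo, hi] when each step S i ⊂ S (i+1) there adds a
-- single element.  The main lemma `explore` states: if the chain is saturated on [lo, hi]
-- (hi = lo + n) and the seen sets satisfy the invariant `Ready` (inside the window only chain
-- members have been seen, above it every alteration has been seen), then the loop performs
-- exactly the steps Rₙ shifted by lo and ends in a state described by `Explored`: every set
-- strictly between S lo and S hi has been seen, nothing else was added, the chain is again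
-- saturated and unchanged outside the window.  It is proved by induction on n, following
-- Rₙ₊₁ = (Rₙ + 1) ∪ [1,…,n] ∪ Rₙ:
--   1. explore the window [lo+1, hi];
--   2. the steps lo+1, …, hi-1 each remove the element w of S (lo+1) ─ S lo from one chain
--      member, shifting the chain down so that C i = S (i+1) ─ ⁅ w ⁆;
--   3. explore the window [lo, hi-1] of this new chain, i.e. the sets not containing w.
-- The theorem is the case lo = 0, hi = m, using that J = {1,…,m-1} initially and J = [] at
-- the end.

open import Defs
open import Data.Nat using (ℕ; zero; suc; _+_; _∸_; _≤_; _<_; z≤n; s≤s; z<s; _<ᵇ_; _≡ᵇ_)
open import Data.Nat.Properties
open import Data.Bool using (true; false; T)
open import Data.Unit using (tt)
open import Data.Empty using (⊥-elim)
open import Data.Product using (Σ; _×_; _,_; proj₁; proj₂)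
open import Data.Sum using (_⊎_; inj₁; inj₂; [_,_]′)
open import Data.Fin using (Fin; toℕ; fromℕ<) renaming (_≟_ to _≟ᶠ_)
open import Data.Fin.Properties using (any?; toℕ-injective; toℕ-fromℕ<)
open import Data.Fin.Subset using (Subset; _∪_; _─_; ⁅_⁆; _⊆_; _⊂_; _∉_; inside; outside)
  renaming (_∈_ to _∈ˢ_)
open import Data.Fin.Subset.Properties
  using (x∈p∪q⁻; p⊆p∪q; q⊆p∪q; x∈p∧x∉q⇒x∈p─q; p─q⊆p; x∈⁅x⁆; x∈⁅y⁆⇒x≡y; x≢y⇒x∉⁅y⁆;
         ⊆-antisym; ⊆-trans; ⊆-reflexive; ⊆-⊂-trans; ⊂-irref)
  renaming (_∈?_ to _∈ˢ?_)
open import Data.Vec using (_∷_; here; there)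
open import Data.Vec.Properties using (lookup∘tabulate; []=⇒lookup; lookup⇒[]=)
open import Data.List using (List; []; _∷_; _++_; map; filter; applyUpTo)
open import Data.List.Properties using (filter-none; filter-all; map-++; map-∘; map-cong; map-applyUpTo; map-id)
open import Data.List.Membership.Propositional using (_∈_)
open import Data.List.Membership.Propositional.Properties
  using (∈-filter⁺; ∈-filter⁻; ∈-++⁺ˡ; ∈-++⁺ʳ; ∈-++⁻; ∈-map⁺; ∈-map⁻; ∈-applyUpTo⁺; ∈-applyUpTo⁻)
open import Data.List.Relation.Unary.Any using (here; there)
open import Data.List.Relation.Unary.All as All using (All; []; _∷_)
open import Relation.Nullary using (¬_; yes; no; ¬?)
open import Relation.Nullary.Decidable using (_×-dec_)
open import Relation.Unary using (Decidable)
open import Relation.Binary.Definitions using (tri<; tri≈; tri>)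
open import Relation.Binary.PropositionalEquality

maxList-lub : ∀ {j} ys → All (_≤ j) ys → maxList ys ≤ j
maxList-lub []       []            = z≤n
maxList-lub (y ∷ ys) (y≤j ∷ ys≤j) = ⊔-lub y≤j (maxList-lub ys ys≤j)

≤-maxList : ∀ {j} ys → j ∈ ys → j ≤ maxList ys
≤-maxList (y ∷ ys) (here refl)  = m≤m⊔n y _
≤-maxList (y ∷ ys) (there j∈ys) = ≤-trans (≤-maxList ys j∈ys) (m≤n⊔m y _)

-- If j is the largest element of xs satisfying P, then filtering xs by P
-- gives a nonempty list with maximum j.  This is how the loop's choice
-- j = max J is identified.
max-filter : ∀ {P : ℕ → Set} (P? : Decidable P) xs j → j ∈ xs → P j →
             (∀ i → i ∈ xs → P i → i ≤ j) →
             filter P? xs ≢ [] × maxList (filter P? xs) ≡ j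
max-filter P? xs j j∈xs Pj largest = nonempty j∈filter , ≤-antisym
  (maxList-lub _ (All.tabulate λ {i} i∈ → let (i∈xs , Pi) = ∈-filter⁻ P? i∈ in largest i i∈xs Pi))
  (≤-maxList _ j∈filter)
  where
  j∈filter : j ∈ filter P? xs
  j∈filter = ∈-filter⁺ P? j∈xs Pj
  nonempty : ∀ {ys : List ℕ} → j ∈ ys → ys ≢ []
  nonempty (here _)  ()
  nonempty (there _) ()

∈-indices⁺ : ∀ {m j} → 1 ≤ j → j < m → j ∈ indices m
∈-indices⁺ {zero}  {_}     _  ()
∈-indices⁺ {suc m} {zero}  () _
∈-indices⁺ {suc m} {suc i} _  (s≤s i<m) = ∈-applyUpTo⁺ (1 +_) i<m

∈-indices⁻ : ∀ {m j} → j ∈ indices m → 1 ≤ j × j < m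
∈-indices⁻ {suc m} j∈ with ∈-applyUpTo⁻ (1 +_) j∈
... | _ , i<m , refl = s≤s z≤n , s≤s i<m

applyUpTo-cong : ∀ {A : Set} {f g : ℕ → A} → (∀ k → f k ≡ g k) → ∀ n → applyUpTo f n ≡ applyUpTo g n
applyUpTo-cong f≗g zero    = refl
applyUpTo-cong f≗g (suc n) = cong₂ _∷_ (f≗g 0) (applyUpTo-cong (λ k → f≗g (suc k)) n)

from-suc : ∀ a n → from a (suc n) ≡ a ∷ from (suc a) n
from-suc a n = cong₂ _∷_ (+-identityʳ a) (applyUpTo-cong (+-suc a) n)

R-suc : ∀ n → R (suc n) ≡ map suc (R n) ++ from 1 n ++ R n
R-suc zero          = refl
R-suc (suc zero)    = refl
R-suc (suc (suc n)) = refl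

R-shift : ∀ lo n → map (lo +_) (R (suc n)) ≡ map (suc lo +_) (R n) ++ from (suc lo) n ++ map (lo +_) (R n)
R-shift lo n = begin
  map (lo +_) (R (suc n))                                             ≡⟨ cong (map (lo +_)) (R-suc n) ⟩
  map (lo +_) (map suc (R n) ++ from 1 n ++ R n)                      ≡⟨ map-++ (lo +_) (map suc (R n)) _ ⟩
  map (lo +_) (map suc (R n)) ++ map (lo +_) (from 1 n ++ R n)        ≡⟨ cong₂ _++_ shift-R
                                                                           (map-++ (lo +_) (from 1 n) (R n)) ⟩
  map (suc lo +_) (R n) ++ map (lo +_) (from 1 n) ++ map (lo +_) (R n) ≡⟨ cong (λ xs → map (suc lo +_) (R n) ++ xs ++ map (lo +_) (R n))
                                                                           shift-from ⟩
  map (suc lo +_) (R n) ++ from (suc lo) n ++ map (lo +_) (R n)       ∎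
  where
  open ≡-Reasoning
  shift-R : map (lo +_) (map suc (R n)) ≡ map (suc lo +_) (R n)
  shift-R = trans (sym (map-∘ (R n))) (map-cong (+-suc lo) (R n))
  shift-from : map (lo +_) (from 1 n) ≡ from (suc lo) n
  shift-from = trans (map-applyUpTo (1 +_) (lo +_) n) (applyUpTo-cong (+-suc lo) n)

x∈p─q⁻ : ∀ {n} (p q : Subset n) {x} → x ∈ˢ p ─ q → x ∈ˢ p × x ∉ q
x∈p─q⁻ (inside  ∷ p) (outside ∷ q) here = here , λ ()
x∈p─q⁻ (outside ∷ p) (outside ∷ q) {Fin.zero} ()
x∈p─q⁻ (outside ∷ p) (inside  ∷ q) {Fin.zero} ()
x∈p─q⁻ (inside  ∷ p) (inside  ∷ q) {Fin.zero} ()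
x∈p─q⁻ (s ∷ p) (t ∷ q) (there x∈) =
  let (x∈p , x∉q) = x∈p─q⁻ p q x∈ in there x∈p , λ { (there x∈q) → x∉q x∈q }

escapes-or-⊆ : ∀ {n} (Y A : Subset n) → (Σ (Fin n) λ y → y ∈ˢ Y × y ∉ A) ⊎ Y ⊆ A
escapes-or-⊆ Y A with any? (λ y → (y ∈ˢ? Y) ×-dec (¬? (y ∈ˢ? A)))
... | yes (y , y∈Y , y∉A) = inj₁ (y , y∈Y , y∉A)
... | no  none            = inj₂ λ {x} x∈Y → inA x x∈Y
  where
  inA : ∀ x → x ∈ˢ Y → x ∈ˢ A
  inA x x∈Y with x ∈ˢ? A
  ... | yes x∈A = x∈A
  ... | no  x∉A = ⊥-elim (none (x , x∈Y , x∉A))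

⊆-─⁅⁆ : ∀ {n} {X A : Subset n} {w} → X ⊆ A → w ∉ X → X ⊆ A ─ ⁅ w ⁆
⊆-─⁅⁆ {X = X} {w = w} X⊆A w∉X x∈ =
  x∈p∧x∉q⇒x∈p─q (X⊆A x∈) (λ x∈w → w∉X (subst (_∈ˢ X) (x∈⁅y⁆⇒x≡y w x∈w) x∈))

module _ {n : ℕ} {A : Subset n} where

  ∈-singleton : ∀ {w x : Fin n} → w ∈ˢ A → x ∈ˢ ⁅ w ⁆ → x ∈ˢ A
  ∈-singleton {w} w∈A x∈w = subst (_∈ˢ A) (sym (x∈⁅y⁆⇒x≡y w x∈w)) w∈A

  exchange : ∀ {z w} → z ∉ A → w ∈ˢ A → (A ─ ⁅ w ⁆) ∪ ((A ∪ ⁅ z ⁆) ─ A) ≡ (A ∪ ⁅ z ⁆) ─ ⁅ w ⁆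
  exchange {z} {w} z∉A w∈A = ⊆-antisym ⊆-part ⊇-part
    where
    ⊆-part : (A ─ ⁅ w ⁆) ∪ ((A ∪ ⁅ z ⁆) ─ A) ⊆ (A ∪ ⁅ z ⁆) ─ ⁅ w ⁆
    ⊆-part x∈ with x∈p∪q⁻ (A ─ ⁅ w ⁆) _ x∈
    ... | inj₁ x∈A─w = let (x∈A , x∉w) = x∈p─q⁻ A ⁅ w ⁆ x∈A─w in
                       x∈p∧x∉q⇒x∈p─q (p⊆p∪q ⁅ z ⁆ x∈A) x∉w
    ... | inj₂ x∈new = let (x∈A+z , x∉A) = x∈p─q⁻ (A ∪ ⁅ z ⁆) A x∈new in
                       x∈p∧x∉q⇒x∈p─q x∈A+z (λ x∈w → x∉A (∈-singleton w∈A x∈w))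
    ⊇-part : (A ∪ ⁅ z ⁆) ─ ⁅ w ⁆ ⊆ (A ─ ⁅ w ⁆) ∪ ((A ∪ ⁅ z ⁆) ─ A)
    ⊇-part {x} x∈ with x∈p─q⁻ (A ∪ ⁅ z ⁆) ⁅ w ⁆ x∈ | x ∈ˢ? A
    ... | _      , x∉w | yes x∈A = p⊆p∪q _ (x∈p∧x∉q⇒x∈p─q x∈A x∉w)
    ... | x∈A+z  , _   | no  x∉A = q⊆p∪q (A ─ ⁅ w ⁆) _ (x∈p∧x∉q⇒x∈p─q x∈A+z x∉A)

  add-remove : ∀ {w} → w ∉ A → (A ∪ ⁅ w ⁆) ─ ⁅ w ⁆ ≡ A
  add-remove {w} w∉A = ⊆-antisym ⊆-part ⊇-part
    where
    ⊆-part : (A ∪ ⁅ w ⁆) ─ ⁅ w ⁆ ⊆ A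
    ⊆-part x∈ with x∈p─q⁻ (A ∪ ⁅ w ⁆) ⁅ w ⁆ x∈
    ... | x∈A+w , x∉w = [ (λ x∈A → x∈A) , (λ x∈w → ⊥-elim (x∉w x∈w)) ]′ (x∈p∪q⁻ A ⁅ w ⁆ x∈A+w)
    ⊇-part : A ⊆ (A ∪ ⁅ w ⁆) ─ ⁅ w ⁆
    ⊇-part = ⊆-─⁅⁆ (p⊆p∪q ⁅ w ⁆) w∉A

  add-remove-comm : ∀ {z w} → z ≢ w → (A ∪ ⁅ z ⁆) ─ ⁅ w ⁆ ≡ (A ─ ⁅ w ⁆) ∪ ⁅ z ⁆
  add-remove-comm {z} {w} z≢w = ⊆-antisym ⊆-part ⊇-part
    where
    ⊆-part : (A ∪ ⁅ z ⁆) ─ ⁅ w ⁆ ⊆ (A ─ ⁅ w ⁆) ∪ ⁅ z ⁆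
    ⊆-part x∈ with x∈p─q⁻ (A ∪ ⁅ z ⁆) ⁅ w ⁆ x∈
    ... | x∈A+z , x∉w = [ (λ x∈A → p⊆p∪q ⁅ z ⁆ (x∈p∧x∉q⇒x∈p─q x∈A x∉w)) , q⊆p∪q (A ─ ⁅ w ⁆) ⁅ z ⁆ ]′
                          (x∈p∪q⁻ A ⁅ z ⁆ x∈A+z)
    ⊇-part : (A ─ ⁅ w ⁆) ∪ ⁅ z ⁆ ⊆ (A ∪ ⁅ z ⁆) ─ ⁅ w ⁆
    ⊇-part x∈ with x∈p∪q⁻ (A ─ ⁅ w ⁆) ⁅ z ⁆ x∈
    ... | inj₁ x∈A─w = let (x∈A , x∉w) = x∈p─q⁻ A ⁅ w ⁆ x∈A─w in x∈p∧x∉q⇒x∈p─q (p⊆p∪q ⁅ z ⁆ x∈A) x∉w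
    ... | inj₂ x∈z   = x∈p∧x∉q⇒x∈p─q (q⊆p∪q A ⁅ z ⁆ x∈z)
                         (λ x∈w → z≢w (trans (sym (x∈⁅y⁆⇒x≡y z x∈z)) (x∈⁅y⁆⇒x≡y w x∈w)))

  remove-add : ∀ {w} → w ∈ˢ A → (A ─ ⁅ w ⁆) ∪ ⁅ w ⁆ ≡ A
  remove-add {w} w∈A = ⊆-antisym ⊆-part ⊇-part
    where
    ⊆-part : (A ─ ⁅ w ⁆) ∪ ⁅ w ⁆ ⊆ A
    ⊆-part x∈ = [ p─q⊆p A ⁅ w ⁆ , ∈-singleton w∈A ]′ (x∈p∪q⁻ (A ─ ⁅ w ⁆) ⁅ w ⁆ x∈)
    ⊇-part : A ⊆ (A ─ ⁅ w ⁆) ∪ ⁅ w ⁆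
    ⊇-part {x} x∈A with x ≟ᶠ w
    ... | yes refl = q⊆p∪q (A ─ ⁅ w ⁆) ⁅ w ⁆ (x∈⁅x⁆ w)
    ... | no  x≢w  = p⊆p∪q ⁅ w ⁆ (x∈p∧x∉q⇒x∈p─q x∈A (x≢y⇒x∉⁅y⁆ x≢w))

  remove-diff : ∀ {w} → w ∈ˢ A → A ─ (A ─ ⁅ w ⁆) ≡ ⁅ w ⁆
  remove-diff {w} w∈A = ⊆-antisym ⊆-part ⊇-part
    where
    ⊆-part : A ─ (A ─ ⁅ w ⁆) ⊆ ⁅ w ⁆
    ⊆-part {x} x∈ with x∈p─q⁻ A (A ─ ⁅ w ⁆) x∈ | x ≟ᶠ w
    ... | _       , _      | yes refl = x∈⁅x⁆ w
    ... | x∈A     , x∉A─w | no  x≢w  = ⊥-elim (x∉A─w (x∈p∧x∉q⇒x∈p─q x∈A (x≢y⇒x∉⁅y⁆ x≢w)))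
    ⊇-part : ⁅ w ⁆ ⊆ A ─ (A ─ ⁅ w ⁆)
    ⊇-part x∈w = x∈p∧x∉q⇒x∈p─q (∈-singleton w∈A x∈w) (λ x∈A─w → proj₂ (x∈p─q⁻ A ⁅ w ⁆ x∈A─w) x∈w)

module _ {m : ℕ} where

  _⋖_ : Subset m → Subset m → Set
  A ⋖ B = Σ (Fin m) λ z → z ∉ A × B ≡ A ∪ ⁅ z ⁆

  cover⊆ : ∀ {A B : Subset m} {z} → B ≡ A ∪ ⁅ z ⁆ → A ⊆ B
  cover⊆ {z = z} refl = p⊆p∪q ⁅ z ⁆

  cover∈ : ∀ {A B : Subset m} {z} → B ≡ A ∪ ⁅ z ⁆ → z ∈ˢ B
  cover∈ {A} {z = z} refl = q⊆p∪q A ⁅ z ⁆ (x∈⁅x⁆ z)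

  Saturated : Chain m → ℕ → ℕ → Set
  Saturated S lo hi = ∀ i → lo ≤ i → i < hi → S i ⋖ S (suc i)

  saturated-mono : ∀ {S lo hi i j} → Saturated S lo hi → lo ≤ i → i ≤ j → j ≤ hi → S i ⊆ S j
  saturated-mono {S} sat lo≤i i≤j j≤hi with m≤n⇒m<n∨m≡n i≤j
  ... | inj₂ refl = λ x∈ → x∈
  ... | inj₁ (s≤s {n = j′} i≤j′) =
    ⊆-trans (saturated-mono sat lo≤i i≤j′ (<⇒≤ j≤hi))
            (cover⊆ (proj₂ (proj₂ (sat j′ (≤-trans lo≤i i≤j′) j≤hi))))

  saturated-strict : ∀ {S lo hi i} → Saturated S lo hi → lo < i → i ≤ hi → S lo ⊂ S i
  saturated-strict sat lo<i i≤hi with sat _ ≤-refl (<-≤-trans lo<i i≤hi)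
  ... | z , z∉ , eq = saturated-mono sat ≤-refl (<⇒≤ lo<i) i≤hi ,
                      z , saturated-mono sat (n≤1+n _) lo<i i≤hi (cover∈ eq) , z∉

  update-same : ∀ (S : Chain m) j X → update S j X j ≡ X
  update-same S j X with j ≡ᵇ j in eq
  ... | true  = refl
  ... | false = ⊥-elim (subst T eq (≡⇒≡ᵇ j j refl))

  update-other : ∀ (S : Chain m) j X k → k ≢ j → update S j X k ≡ S k
  update-other S j X k k≢j with k ≡ᵇ j in eq
  ... | true  = ⊥-elim (k≢j (≡ᵇ⇒≡ k j (subst T (sym eq) tt)))
  ... | false = refl

  -- Partial runs of the loop: Steps S 𝒮 G S′ 𝒮′ says that from (S, 𝒮) the
  -- loop performs the steps G (each the maximum of the current J) and
  -- arrives at (S′, 𝒮′).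
  data Steps : Chain m → List (Subset m) → List ℕ → Chain m → List (Subset m) → Set where
    done : ∀ {S 𝒮} → Steps S 𝒮 [] S 𝒮
    step : ∀ {S 𝒮 j G S′ 𝒮′} → computeJ m S 𝒮 ≢ [] → maxList (computeJ m S 𝒮) ≡ j →
           Steps (update S j (alt S j)) (𝒮 ++ (update S j (alt S j) j ∷ [])) G S′ 𝒮′ →
           Steps S 𝒮 (j ∷ G) S′ 𝒮′

  steps-++ : ∀ {S 𝒮 G₁ S₁ 𝒮₁ G₂ S₂ 𝒮₂} → Steps S 𝒮 G₁ S₁ 𝒮₁ → Steps S₁ 𝒮₁ G₂ S₂ 𝒮₂ →
             Steps S 𝒮 (G₁ ++ G₂) S₂ 𝒮₂
  steps-++ done           rest = rest
  steps-++ (step ne j s) rest = step ne j (steps-++ s rest)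

  steps⇒run : ∀ {S 𝒮 G S′ 𝒮′} → Steps S 𝒮 G S′ 𝒮′ → computeJ m S′ 𝒮′ ≡ [] →
              GreedyRun m S 𝒮 (computeJ m S 𝒮) G
  steps⇒run done              J≡[] rewrite J≡[] = stop
  steps⇒run (step ne refl s) J≡[] = step ne (steps⇒run s J≡[])

  computeJ-max : ∀ S 𝒮 j → 1 ≤ j → j < m → ¬ (alt S j ∈ 𝒮) → (∀ i → j < i → i < m → alt S i ∈ 𝒮) →
                 computeJ m S 𝒮 ≢ [] × maxList (computeJ m S 𝒮) ≡ j
  computeJ-max S 𝒮 j 1≤j j<m new seen = max-filter _ (indices m) j (∈-indices⁺ 1≤j j<m) new largest
    where
    largest : ∀ i → i ∈ indices m → ¬ (alt S i ∈ 𝒮) → i ≤ j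
    largest i i∈ new-i with j <? i
    ... | yes j<i = ⊥-elim (new-i (seen i j<i (proj₂ (∈-indices⁻ {m} i∈))))
    ... | no  j≮i = ≮⇒≥ j≮i

  computeJ-empty : ∀ S 𝒮 → (∀ i → 1 ≤ i → i < m → alt S i ∈ 𝒮) → computeJ m S 𝒮 ≡ []
  computeJ-empty S 𝒮 seen = filter-none _ {indices m} (All.tabulate λ i∈ new →
    let (1≤i , i<m) = ∈-indices⁻ {m} i∈ in new (seen _ 1≤i i<m))

  alt-agree-above : ∀ {S D : Chain m} k → (∀ i → k ≤ i → S i ≡ D i) → ∀ i → k < i → alt S i ≡ alt D i
  alt-agree-above k agree (suc i) (s≤s k≤i) =
    cong₂ _∪_ (agree i k≤i)
              (cong₂ _─_ (agree (suc (suc i)) (≤-trans k≤i (≤-trans (n≤1+n i) (n≤1+n (suc i)))))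
                         (agree (suc i) (m≤n⇒m≤1+n k≤i)))

  alt-between : ∀ {S a b} i → Saturated S a b → a < i → i < b → S a ⊂ alt S i × alt S i ⊆ S b
  alt-between {S} {a} {b} (suc i) sat (s≤s a≤i) si<b with sat (suc i) (m≤n⇒m≤1+n a≤i) si<b
  ... | z , z∉ , eqz = (above , z , z∈alt , λ z∈Sa → z∉ (saturated-mono sat ≤-refl (m≤n⇒m≤1+n a≤i) i+1≤b z∈Sa)) ,
                       below
    where
    i≤b : i ≤ b
    i≤b = ≤-trans (n≤1+n i) (<⇒≤ si<b)
    i+1≤b : suc i ≤ b
    i+1≤b = <⇒≤ si<b
    above : S a ⊆ alt S (suc i)
    above x∈Sa = p⊆p∪q _ (saturated-mono sat ≤-refl a≤i i≤b x∈Sa)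
    z∈alt : z ∈ˢ alt S (suc i)
    z∈alt = q⊆p∪q (S i) _ (x∈p∧x∉q⇒x∈p─q (cover∈ eqz) z∉)
    below : alt S (suc i) ⊆ S b
    below x∈ = [ saturated-mono sat a≤i i≤b ≤-refl
               , (λ x∈new → saturated-mono sat (≤-trans a≤i (≤-trans (n≤1+n i) (n≤1+n (suc i)))) si<b ≤-refl
                                          (p─q⊆p (S (suc (suc i))) (S (suc i)) x∈new)) ]′
               (x∈p∪q⁻ (S i) _ x∈)

  -- … and it is not itself a member of the chain: if S (i-1) ⋖ S i adds y and
  -- S i ⋖ S (i+1) adds z, then alt S i contains z but not y.
  alt-off-chain : ∀ {S a b} i → Saturated S a b → a < i → i < b → ∀ k → a ≤ k → k ≤ b → alt S i ≢ S k
  alt-off-chain {S} {a} {b} (suc i) sat (s≤s a≤i) si<b k a≤k k≤b alt≡Sk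
    with sat i a≤i (<-trans (n<1+n i) si<b) | sat (suc i) (m≤n⇒m≤1+n a≤i) si<b | k ≤? suc i
  ... | _ | z , z∉ , eqz | yes k≤i+1 =
    z∉ (saturated-mono sat a≤k k≤i+1 (<⇒≤ si<b)
          (subst (z ∈ˢ_) alt≡Sk (q⊆p∪q (S i) _ (x∈p∧x∉q⇒x∈p─q (cover∈ eqz) z∉))))
  ... | y , y∉ , eqy | _ | no k≰i+1 =
    [ y∉ , (λ y∈new → proj₂ (x∈p─q⁻ (S (suc (suc i))) (S (suc i)) y∈new) (cover∈ eqy)) ]′
      (x∈p∪q⁻ (S i) _ (subst (y ∈ˢ_) (sym alt≡Sk)
        (saturated-mono sat (m≤n⇒m≤1+n a≤i) (<⇒≤ (≰⇒> k≰i+1)) k≤b (cover∈ eqy))))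

  record Ready (S : Chain m) (𝒮 : List (Subset m)) (lo hi : ℕ) : Set where
    field
      sat        : Saturated S lo hi
      only-chain : ∀ X → S lo ⊂ X → X ⊆ S hi → X ∈ 𝒮 → Σ ℕ λ k → lo < k × k ≤ hi × X ≡ S k
      chain-seen : ∀ k → lo < k → k ≤ hi → S k ∈ 𝒮
      hi≤m       : hi ≤ m
      edge-seen  : hi < m → ∀ Y → S lo ⊆ Y → Y ⊆ S hi → Y ∪ (S (suc hi) ─ S hi) ∈ 𝒮
      above-seen : ∀ i → hi < i → i < m → alt S i ∈ 𝒮

  record Explored (S : Chain m) (𝒮 : List (Subset m)) (lo hi : ℕ) (G : List ℕ) : Set where
    field
      chain    : Chain m
      seen     : List (Subset m)
      run      : Steps S 𝒮 G chain seen
      fixed    : ∀ i → i ≤ lo ⊎ hi ≤ i → chain i ≡ S i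
      sat′     : Saturated chain lo hi
      complete : ∀ X → S lo ⊂ X → X ⊆ S hi → X ∈ seen
      grows    : ∀ X → X ∈ 𝒮 → X ∈ seen
      confined : ∀ X → X ∈ seen → X ∈ 𝒮 ⊎ (S lo ⊂ X × X ⊆ S hi)

  module InductiveStep (n lo hi : ℕ) (e : lo + suc n ≡ hi) (S : Chain m) (𝒮 : List (Subset m))
                       (ready : Ready S 𝒮 lo hi) where
    open Ready ready

    mid : ℕ
    mid = lo + n

    mid+1≡hi : suc mid ≡ hi
    mid+1≡hi = trans (sym (+-suc lo n)) e

    lo<hi : lo < hi
    lo<hi = subst (lo <_) mid+1≡hi (s≤s (m≤m+n lo n))

    mid<hi : mid < hi
    mid<hi = subst (mid <_) mid+1≡hi (n<1+n mid)

    w : Fin m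
    w = proj₁ (sat lo ≤-refl lo<hi)

    w∉S-lo : w ∉ S lo
    w∉S-lo = proj₁ (proj₂ (sat lo ≤-refl lo<hi))

    S-lo+1 : S (suc lo) ≡ S lo ∪ ⁅ w ⁆
    S-lo+1 = proj₂ (proj₂ (sat lo ≤-refl lo<hi))

    w∈S : ∀ k → lo < k → k ≤ hi → w ∈ˢ S k
    w∈S k lo<k k≤hi = saturated-mono sat (n≤1+n lo) lo<k k≤hi (cover∈ S-lo+1)

    w∈S-hi : w ∈ˢ S hi
    w∈S-hi = w∈S hi lo<hi ≤-refl

    <hi⇒≤mid : ∀ {i} → i < hi → i ≤ mid
    <hi⇒≤mid i<hi = ≤-pred (subst (_ <_) (sym mid+1≡hi) i<hi)

    S-lo+1-seen : S (suc lo) ∈ 𝒮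
    S-lo+1-seen = chain-seen (suc lo) ≤-refl lo<hi

    S-lo+1⊆ : ∀ {X} → S lo ⊆ X → w ∈ˢ X → S (suc lo) ⊆ X
    S-lo+1⊆ S-lo⊆X w∈X x∈ = [ S-lo⊆X , ∈-singleton w∈X ]′ (x∈p∪q⁻ (S lo) ⁅ w ⁆ (⊆-reflexive S-lo+1 x∈))

    ready-right : Ready S 𝒮 (suc lo) hi
    ready-right = record
      { sat        = λ i lo<i → sat i (≤-trans (n≤1+n lo) lo<i)
      ; only-chain = only-chain′
      ; chain-seen = λ k lo+1<k → chain-seen k (≤-trans (n≤1+n (suc lo)) lo+1<k)
      ; hi≤m       = hi≤m
      ; edge-seen  = λ hi<m Y S-lo+1⊆Y → edge-seen hi<m Y (⊆-trans (cover⊆ S-lo+1) S-lo+1⊆Y)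
      ; above-seen = above-seen
      }
      where
      only-chain′ : ∀ X → S (suc lo) ⊂ X → X ⊆ S hi → X ∈ 𝒮 → Σ ℕ λ k → suc lo < k × k ≤ hi × X ≡ S k
      only-chain′ X S-lo+1⊂X X⊆ X∈ with only-chain X (⊆-⊂-trans (cover⊆ S-lo+1) S-lo+1⊂X) X⊆ X∈
      ... | k , lo<k , k≤hi , refl with m≤n⇒m<n∨m≡n lo<k
      ...   | inj₁ lo+1<k = k , lo+1<k , k≤hi , refl
      ...   | inj₂ refl   = ⊥-elim (⊂-irref refl S-lo+1⊂X)

    module AfterLeft {G₁ : List ℕ} (left : Explored S 𝒮 (suc lo) hi G₁) where
      open Explored left
        renaming (chain to S₁; seen to 𝒮₁; run to run₁; fixed to fixed₁; sat′ to sat₁;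
                  complete to complete₁; grows to grows₁; confined to confined₁)

      S₁-lo : S₁ lo ≡ S lo
      S₁-lo = fixed₁ lo (inj₁ (n≤1+n lo))

      S₁-lo+1 : S₁ (suc lo) ≡ S (suc lo)
      S₁-lo+1 = fixed₁ (suc lo) (inj₁ ≤-refl)

      S₁-≥hi : ∀ i → hi ≤ i → S₁ i ≡ S i
      S₁-≥hi i hi≤i = fixed₁ i (inj₂ hi≤i)

      S₁-mono : ∀ {i j} → suc lo ≤ i → i ≤ j → j ≤ hi → S₁ i ⊆ S₁ j
      S₁-mono = saturated-mono sat₁

      w∈S₁ : ∀ k → suc lo ≤ k → k ≤ hi → w ∈ˢ S₁ k
      w∈S₁ k lo<k k≤hi = S₁-mono ≤-refl lo<k k≤hi (⊆-reflexive (sym S₁-lo+1) (cover∈ S-lo+1))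

      S-lo⊆S₁ : ∀ k → suc lo ≤ k → k ≤ hi → S lo ⊆ S₁ k
      S-lo⊆S₁ k lo<k k≤hi x∈ = S₁-mono ≤-refl lo<k k≤hi (⊆-reflexive (sym S₁-lo+1) (cover⊆ S-lo+1 x∈))

      S₁⊆S-hi : ∀ k → suc lo ≤ k → k ≤ hi → S₁ k ⊆ S hi
      S₁⊆S-hi k lo<k k≤hi x∈ = ⊆-reflexive (S₁-≥hi hi ≤-refl) (S₁-mono lo<k k≤hi ≤-refl x∈)

      -- The invariant of phase 2 after the steps lo+1, …, p-1: below p, w has been
      -- removed from the chain (C i = S₁ (i+1) ─ ⁅ w ⁆), the rest is untouched, and the
      -- only new seen sets are the modified chain members.
      record Shifted (p : ℕ) (C : Chain m) (𝒮c : List (Subset m)) : Set where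
        field
          unmoved    : ∀ i → i ≤ lo ⊎ p ≤ i → C i ≡ S₁ i
          moved      : ∀ i → lo ≤ i → i < p → C i ≡ S₁ (suc i) ─ ⁅ w ⁆
          origin     : ∀ X → X ∈ 𝒮c → X ∈ 𝒮₁ ⊎ Σ ℕ λ i → lo < i × i < p × X ≡ C i
          keeps      : ∀ X → X ∈ 𝒮₁ → X ∈ 𝒮c
          moved-seen : ∀ i → lo < i → i < p → C i ∈ 𝒮c

      shift-start : Shifted (suc lo) S₁ 𝒮₁
      shift-start = record
        { unmoved    = λ _ _ → refl
        ; moved      = moved-lo
        ; origin     = λ _ X∈ → inj₁ X∈
        ; keeps      = λ _ X∈ → X∈
        ; moved-seen = λ i lo<i i<lo+1 → ⊥-elim (<⇒≱ i<lo+1 lo<i)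
        }
        where
        moved-lo : ∀ i → lo ≤ i → i < suc lo → S₁ i ≡ S₁ (suc i) ─ ⁅ w ⁆
        moved-lo i lo≤i i<lo+1 with ≤-antisym (≤-pred i<lo+1) lo≤i
        ... | refl = begin
          S₁ lo                        ≡⟨ S₁-lo ⟩
          S lo                         ≡⟨ add-remove w∉S-lo ⟨
          (S lo ∪ ⁅ w ⁆) ─ ⁅ w ⁆       ≡⟨ cong (_─ ⁅ w ⁆) (trans (sym S-lo+1) (sym S₁-lo+1)) ⟩
          S₁ (suc lo) ─ ⁅ w ⁆          ∎
          where open ≡-Reasoning

      module ShiftStep (p′ : ℕ) (lo<p : suc lo ≤ suc p′) (p<hi : suc p′ < hi)
                       (C : Chain m) (𝒮c : List (Subset m)) (inv : Shifted (suc p′) C 𝒮c) where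
        open Shifted inv

        p : ℕ
        p = suc p′

        z : Fin m
        z = proj₁ (sat₁ p lo<p p<hi)

        z∉S₁-p : z ∉ S₁ p
        z∉S₁-p = proj₁ (proj₂ (sat₁ p lo<p p<hi))

        S₁-p+1 : S₁ (suc p) ≡ S₁ p ∪ ⁅ z ⁆
        S₁-p+1 = proj₂ (proj₂ (sat₁ p lo<p p<hi))

        N : Subset m
        N = S₁ (suc p) ─ ⁅ w ⁆

        alt≡N : alt C p ≡ N
        alt≡N = begin
          C p′ ∪ (C (suc p) ─ C p)                   ≡⟨ cong₂ _∪_ (moved p′ (≤-pred lo<p) (n<1+n p′))
                                                          (cong₂ _─_ (unmoved (suc p) (inj₂ (n≤1+n p)))
                                                                     (unmoved p (inj₂ ≤-refl))) ⟩
          (S₁ p ─ ⁅ w ⁆) ∪ (S₁ (suc p) ─ S₁ p)        ≡⟨ cong (λ B → (S₁ p ─ ⁅ w ⁆) ∪ (B ─ S₁ p)) S₁-p+1 ⟩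
          (S₁ p ─ ⁅ w ⁆) ∪ ((S₁ p ∪ ⁅ z ⁆) ─ S₁ p)    ≡⟨ exchange z∉S₁-p (w∈S₁ p lo<p (<⇒≤ p<hi)) ⟩
          (S₁ p ∪ ⁅ z ⁆) ─ ⁅ w ⁆                      ≡⟨ cong (_─ ⁅ w ⁆) S₁-p+1 ⟨
          N                                          ∎
          where open ≡-Reasoning

        w∉N : w ∉ N
        w∉N w∈N = proj₂ (x∈p─q⁻ (S₁ (suc p)) ⁅ w ⁆ w∈N) (x∈⁅x⁆ w)

        z∈N : z ∈ˢ N
        z∈N = x∈p∧x∉q⇒x∈p─q (cover∈ S₁-p+1)
                (x≢y⇒x∉⁅y⁆ λ z≡w → z∉S₁-p (subst (_∈ˢ S₁ p) (sym z≡w) (w∈S₁ p lo<p (<⇒≤ p<hi))))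

        S-lo⊂N⊆S-hi : S lo ⊂ N × N ⊆ S hi
        S-lo⊂N⊆S-hi =
          ( ⊆-─⁅⁆ (S-lo⊆S₁ (suc p) (m≤n⇒m≤1+n lo<p) p<hi) w∉S-lo
          , z , z∈N , (λ z∈ → z∉S₁-p (S-lo⊆S₁ p lo<p (<⇒≤ p<hi) z∈)) )
          , (λ x∈ → S₁⊆S-hi (suc p) (m≤n⇒m≤1+n lo<p) p<hi (p─q⊆p (S₁ (suc p)) ⁅ w ⁆ x∈))

        -- N has not been seen: it lacks w, so it is none of the sets seen in phase 1 or
        -- before, and it contains z, so it is none of the sets C i (i < p) seen in phase 2.
        N-unseen : ¬ (N ∈ 𝒮c)
        N-unseen N∈ with origin N N∈
        ... | inj₂ (i , lo<i , i<p , N≡Ci) =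
          z∉S₁-p (S₁-mono (m≤n⇒m≤1+n lo<i) i<p (<⇒≤ p<hi)
                   (p─q⊆p (S₁ (suc i)) ⁅ w ⁆ (subst (z ∈ˢ_) (trans N≡Ci (moved i (<⇒≤ lo<i) i<p)) z∈N)))
        ... | inj₁ N∈𝒮₁ with confined₁ N N∈𝒮₁
        ...   | inj₂ (S-lo+1⊂N , _) = w∉N (proj₁ S-lo+1⊂N (cover∈ S-lo+1))
        ...   | inj₁ N∈𝒮 with only-chain N (proj₁ S-lo⊂N⊆S-hi) (proj₂ S-lo⊂N⊆S-hi) N∈𝒮
        ...     | k , lo<k , k≤hi , N≡Sk = w∉N (subst (w ∈ˢ_) (sym N≡Sk) (w∈S k lo<k k≤hi))

        -- Every alteration above p has been seen: below hi it is one of the sets explored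
        -- in phase 1, at hi it is covered by edge-seen, and above hi by above-seen.
        above-p-seen : ∀ i → p < i → i < m → alt C i ∈ 𝒮c
        above-p-seen i p<i i<m with <-cmp i hi
        ... | tri< i<hi _ _ =
          let (S₁-lo+1⊂ , ⊆S₁-hi) = alt-between i sat₁ (≤-<-trans lo<p p<i) i<hi in
          subst (_∈ 𝒮c) (sym (alt-agree-above p (λ x p≤x → unmoved x (inj₂ p≤x)) i p<i))
            (keeps _ (complete₁ _ (subst (_⊂ alt S₁ i) S₁-lo+1 S₁-lo+1⊂)
                                  (λ x∈ → ⊆-reflexive (S₁-≥hi hi ≤-refl) (⊆S₁-hi x∈))))
        ... | tri≈ _ refl _ =
          let p≤hi-1 = <⇒≤pred p<hi
              hi-1≤hi = m∸n≤m hi 1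
          in subst (_∈ 𝒮c)
               (sym (cong₂ _∪_ (unmoved (hi ∸ 1) (inj₂ p≤hi-1))
                       (cong₂ _─_ (trans (unmoved (suc hi) (inj₂ (≤-trans (<⇒≤ p<hi) (n≤1+n hi))))
                                         (S₁-≥hi (suc hi) (n≤1+n hi)))
                                  (trans (unmoved hi (inj₂ (<⇒≤ p<hi))) (S₁-≥hi hi ≤-refl)))))
               (keeps _ (grows₁ _ (edge-seen i<m (S₁ (hi ∸ 1))
                   (S-lo⊆S₁ (hi ∸ 1) (≤-trans lo<p p≤hi-1) hi-1≤hi)
                   (S₁⊆S-hi (hi ∸ 1) (≤-trans lo<p p≤hi-1) hi-1≤hi))))
        ... | tri> _ _ hi<i =
          subst (_∈ 𝒮c)
            (sym (alt-agree-above hi (λ x hi≤x → trans (unmoved x (inj₂ (≤-trans (<⇒≤ p<hi) hi≤x)))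
                                                       (S₁-≥hi x hi≤x)) i hi<i))
            (keeps _ (grows₁ _ (above-seen i hi<i i<m)))

        chosen : computeJ m C 𝒮c ≢ [] × maxList (computeJ m C 𝒮c) ≡ p
        chosen = computeJ-max C 𝒮c p (s≤s z≤n) (<-≤-trans p<hi hi≤m)
                   (λ alt∈ → N-unseen (subst (_∈ 𝒮c) alt≡N alt∈)) above-p-seen

        C′ : Chain m
        C′ = update C p (alt C p)

        C′-p : C′ p ≡ N
        C′-p = trans (update-same C p (alt C p)) alt≡N

        C′-other : ∀ i → i ≢ p → C′ i ≡ C i
        C′-other i i≢p = update-other C p (alt C p) i i≢p

        𝒮c′ : List (Subset m)
        𝒮c′ = 𝒮c ++ (C′ p ∷ [])

        next : Shifted (suc p) C′ 𝒮c′
        next = record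
          { unmoved    = unmoved′
          ; moved      = moved′
          ; origin     = origin′
          ; keeps      = λ X X∈ → ∈-++⁺ˡ (keeps X X∈)
          ; moved-seen = moved-seen′
          }
          where
          unmoved′ : ∀ i → i ≤ lo ⊎ suc p ≤ i → C′ i ≡ S₁ i
          unmoved′ i (inj₁ i≤lo) = trans (C′-other i (λ { refl → <⇒≱ lo<p i≤lo })) (unmoved i (inj₁ i≤lo))
          unmoved′ i (inj₂ p<i)  = trans (C′-other i (λ { refl → n≮n p p<i })) (unmoved i (inj₂ (<⇒≤ p<i)))
          moved′ : ∀ i → lo ≤ i → i < suc p → C′ i ≡ S₁ (suc i) ─ ⁅ w ⁆
          moved′ i lo≤i i<p+1 with i ≟ p
          ... | yes refl = C′-p
          ... | no  i≢p  = trans (C′-other i i≢p) (moved i lo≤i (≤∧≢⇒< (≤-pred i<p+1) i≢p))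
          origin′ : ∀ X → X ∈ 𝒮c′ → X ∈ 𝒮₁ ⊎ Σ ℕ λ i → lo < i × i < suc p × X ≡ C′ i
          origin′ X X∈ with ∈-++⁻ 𝒮c X∈
          ... | inj₂ (here refl) = inj₂ (p , lo<p , n<1+n p , refl)
          ... | inj₁ X∈𝒮c with origin X X∈𝒮c
          ...   | inj₁ X∈𝒮₁               = inj₁ X∈𝒮₁
          ...   | inj₂ (i , lo<i , i<p , X≡Ci) =
                    inj₂ (i , lo<i , m≤n⇒m≤1+n i<p , trans X≡Ci (sym (C′-other i (<⇒≢ i<p))))
          moved-seen′ : ∀ i → lo < i → i < suc p → C′ i ∈ 𝒮c′
          moved-seen′ i lo<i i<p+1 with i ≟ p
          ... | yes refl = ∈-++⁺ʳ 𝒮c (here refl)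
          ... | no  i≢p  = subst (_∈ 𝒮c′) (sym (C′-other i i≢p))
                             (∈-++⁺ˡ (moved-seen i lo<i (≤∧≢⇒< (≤-pred i<p+1) i≢p)))

      shift : ∀ r p → suc lo ≤ p → p + r ≡ hi → ∀ C 𝒮c → Shifted p C 𝒮c →
              Σ (Chain m) λ C′ → Σ (List (Subset m)) λ 𝒮′ → Steps C 𝒮c (from p r) C′ 𝒮′ × Shifted hi C′ 𝒮′
      shift zero    p        _    p+0≡hi C 𝒮c inv =
        C , 𝒮c , done , subst (λ q → Shifted q C 𝒮c) (trans (sym (+-identityʳ p)) p+0≡hi) inv
      shift (suc r) (suc p′) lo<p p+r+1≡hi C 𝒮c inv =
        let (C″ , 𝒮″ , steps , inv″) = shift r (suc p) (m≤n⇒m≤1+n lo<p) (trans (sym (+-suc p r)) p+r+1≡hi) C′ 𝒮c′ next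
        in C″ , 𝒮″ , subst (λ G → Steps C 𝒮c G C″ 𝒮″) (sym (from-suc p r)) (step (proj₁ chosen) (proj₂ chosen) steps) ,
           inv″
        where
        open ShiftStep p′ lo<p (subst (suc p′ <_) p+r+1≡hi (m<m+n (suc p′) z<s)) C 𝒮c inv

      phase₂ : Σ (Chain m) λ C₂ → Σ (List (Subset m)) λ 𝒮₂ →
                 Steps S₁ 𝒮₁ (from (suc lo) n) C₂ 𝒮₂ × Shifted hi C₂ 𝒮₂
      phase₂ = shift n (suc lo) ≤-refl mid+1≡hi S₁ 𝒮₁ shift-start

      C₂ : Chain m
      C₂ = proj₁ phase₂

      𝒮₂ : List (Subset m)
      𝒮₂ = proj₁ (proj₂ phase₂)

      steps₂ : Steps S₁ 𝒮₁ (from (suc lo) n) C₂ 𝒮₂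
      steps₂ = proj₁ (proj₂ (proj₂ phase₂))

      -- Facts about the chain C₂ after phase 2: below hi it is S₁ shifted down by one
      -- with w removed, so on [lo, mid] it again is a saturated chain from S lo to S hi ─ ⁅ w ⁆.
      module AfterShift where
        open Shifted (proj₂ (proj₂ (proj₂ phase₂))) public

        C₂-lo : C₂ lo ≡ S lo
        C₂-lo = trans (unmoved lo (inj₁ ≤-refl)) S₁-lo

        C₂-≥hi : ∀ i → hi ≤ i → C₂ i ≡ S i
        C₂-≥hi i hi≤i = trans (unmoved i (inj₂ hi≤i)) (S₁-≥hi i hi≤i)

        C₂-mid+1 : C₂ (suc mid) ≡ S hi
        C₂-mid+1 = trans (cong C₂ mid+1≡hi) (C₂-≥hi hi ≤-refl)

        C₂-mid : C₂ mid ≡ S hi ─ ⁅ w ⁆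
        C₂-mid = trans (moved mid (m≤m+n lo n) mid<hi)
                       (cong (_─ ⁅ w ⁆) (trans (cong S₁ mid+1≡hi) (S₁-≥hi hi ≤-refl)))

        w∉C₂-mid : w ∉ C₂ mid
        w∉C₂-mid w∈ = proj₂ (x∈p─q⁻ (S hi) ⁅ w ⁆ (⊆-reflexive C₂-mid w∈)) (x∈⁅x⁆ w)

        C₂-mid⊆S-hi : C₂ mid ⊆ S hi
        C₂-mid⊆S-hi x∈ = p─q⊆p (S hi) ⁅ w ⁆ (⊆-reflexive C₂-mid x∈)

        S-lo⊆C₂-mid : S lo ⊆ C₂ mid
        S-lo⊆C₂-mid x∈ = ⊆-reflexive (sym C₂-mid)
                           (⊆-─⁅⁆ (saturated-mono sat ≤-refl (<⇒≤ lo<hi) ≤-refl) w∉S-lo x∈)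

        sat-left : Saturated C₂ lo mid
        sat-left i lo≤i i<mid = z , z∉C₂-i , C₂-i+1
          where
          i<hi : i < hi
          i<hi = <-trans i<mid mid<hi
          i+1<hi : suc i < hi
          i+1<hi = subst (suc i <_) mid+1≡hi (s≤s i<mid)
          covers : S₁ (suc i) ⋖ S₁ (suc (suc i))
          covers = sat₁ (suc i) (s≤s lo≤i) i+1<hi
          z : Fin m
          z = proj₁ covers
          z∉S₁ : z ∉ S₁ (suc i)
          z∉S₁ = proj₁ (proj₂ covers)
          z≢w : z ≢ w
          z≢w z≡w = z∉S₁ (subst (_∈ˢ S₁ (suc i)) (sym z≡w) (w∈S₁ (suc i) (s≤s lo≤i) (<⇒≤ i+1<hi)))
          z∉C₂-i : z ∉ C₂ i
          z∉C₂-i z∈ = z∉S₁ (p─q⊆p (S₁ (suc i)) ⁅ w ⁆ (⊆-reflexive (moved i lo≤i i<hi) z∈))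
          C₂-i+1 : C₂ (suc i) ≡ C₂ i ∪ ⁅ z ⁆
          C₂-i+1 = begin
            C₂ (suc i)                         ≡⟨ moved (suc i) (m≤n⇒m≤1+n lo≤i) i+1<hi ⟩
            S₁ (suc (suc i)) ─ ⁅ w ⁆           ≡⟨ cong (_─ ⁅ w ⁆) (proj₂ (proj₂ covers)) ⟩
            (S₁ (suc i) ∪ ⁅ z ⁆) ─ ⁅ w ⁆       ≡⟨ add-remove-comm z≢w ⟩
            (S₁ (suc i) ─ ⁅ w ⁆) ∪ ⁅ z ⁆       ≡⟨ cong (_∪ ⁅ z ⁆) (moved i lo≤i i<hi) ⟨
            C₂ i ∪ ⁅ z ⁆                       ∎
            where open ≡-Reasoning

        -- Seen sets strictly between C₂ lo and C₂ mid lack w, so they can only be the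
        -- chain members created in phase 2.
        only-chain-left : ∀ X → C₂ lo ⊂ X → X ⊆ C₂ mid → X ∈ 𝒮₂ → Σ ℕ λ k → lo < k × k ≤ mid × X ≡ C₂ k
        only-chain-left X C₂-lo⊂X X⊆ X∈ with origin X X∈
        ... | inj₂ (i , lo<i , i<hi , X≡C₂i) = i , lo<i , <hi⇒≤mid i<hi , X≡C₂i
        ... | inj₁ X∈𝒮₁ with confined₁ X X∈𝒮₁
        ...   | inj₂ (S-lo+1⊂X , _) = ⊥-elim (w∉C₂-mid (X⊆ (proj₁ S-lo+1⊂X (cover∈ S-lo+1))))
        ...   | inj₁ X∈𝒮 with only-chain X (subst (_⊂ X) C₂-lo C₂-lo⊂X) (⊆-trans X⊆ C₂-mid⊆S-hi) X∈𝒮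
        ...     | k , lo<k , k≤hi , X≡Sk = ⊥-elim (w∉C₂-mid (X⊆ (subst (w ∈ˢ_) (sym X≡Sk) (w∈S k lo<k k≤hi))))

        -- The alteration at mid adds w back; the results, sets Y ∪ ⁅ w ⁆ between S (lo+1)
        -- and S hi, were seen in phase 1 or before.
        edge-seen-left : mid < m → ∀ Y → C₂ lo ⊆ Y → Y ⊆ C₂ mid → Y ∪ (C₂ (suc mid) ─ C₂ mid) ∈ 𝒮₂
        edge-seen-left _ Y C₂-lo⊆Y Y⊆ = subst (_∈ 𝒮₂) (sym edge≡) Y+w-seen
          where
          edge≡ : Y ∪ (C₂ (suc mid) ─ C₂ mid) ≡ Y ∪ ⁅ w ⁆
          edge≡ = trans (cong₂ (λ A B → Y ∪ (A ─ B)) C₂-mid+1 C₂-mid) (cong (Y ∪_) (remove-diff w∈S-hi))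
          S-lo⊆Y : S lo ⊆ Y
          S-lo⊆Y = ⊆-trans (⊆-reflexive (sym C₂-lo)) C₂-lo⊆Y
          w∉Y : w ∉ Y
          w∉Y w∈ = w∉C₂-mid (Y⊆ w∈)
          Y+w-seen : Y ∪ ⁅ w ⁆ ∈ 𝒮₂
          Y+w-seen with escapes-or-⊆ Y (S lo)
          ... | inj₁ (y , y∈Y , y∉S-lo) = keeps _ (complete₁ _ S-lo+1⊂ ⊆S-hi)
            where
            S-lo+1⊂ : S (suc lo) ⊂ Y ∪ ⁅ w ⁆
            S-lo+1⊂ = S-lo+1⊆ (⊆-trans S-lo⊆Y (p⊆p∪q ⁅ w ⁆)) (q⊆p∪q Y ⁅ w ⁆ (x∈⁅x⁆ w)) ,
                      y , p⊆p∪q ⁅ w ⁆ y∈Y ,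
                      λ y∈ → [ y∉S-lo , (λ y∈w → w∉Y (subst (_∈ˢ Y) (x∈⁅y⁆⇒x≡y w y∈w) y∈Y)) ]′
                               (x∈p∪q⁻ (S lo) ⁅ w ⁆ (⊆-reflexive S-lo+1 y∈))
            ⊆S-hi : Y ∪ ⁅ w ⁆ ⊆ S hi
            ⊆S-hi x∈ = [ (λ x∈Y → C₂-mid⊆S-hi (Y⊆ x∈Y)) , ∈-singleton w∈S-hi ]′ (x∈p∪q⁻ Y ⁅ w ⁆ x∈)
          ... | inj₂ Y⊆S-lo = keeps _ (grows₁ _ (subst (_∈ 𝒮) (sym Y+w≡) S-lo+1-seen))
            where
            Y+w≡ : Y ∪ ⁅ w ⁆ ≡ S (suc lo)
            Y+w≡ = trans (cong (_∪ ⁅ w ⁆) (⊆-antisym Y⊆S-lo S-lo⊆Y)) (sym S-lo+1)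

        -- At and above hi the chain is the original one, so those alterations were seen.
        above-seen-left : ∀ i → mid < i → i < m → alt C₂ i ∈ 𝒮₂
        above-seen-left i mid<i i<m with m≤n⇒m<n∨m≡n (subst (_≤ i) mid+1≡hi mid<i)
        ... | inj₂ refl = subst (_∈ 𝒮₂) (sym alt≡)
                            (keeps _ (grows₁ _ (edge-seen i<m (C₂ mid) S-lo⊆C₂-mid C₂-mid⊆S-hi)))
          where
          alt≡ : alt C₂ hi ≡ C₂ mid ∪ (S (suc hi) ─ S hi)
          alt≡ = cong₂ _∪_ (cong (λ k → C₂ (k ∸ 1)) (sym mid+1≡hi))
                           (cong₂ _─_ (C₂-≥hi (suc hi) (n≤1+n hi)) (C₂-≥hi hi ≤-refl))
        ... | inj₁ hi<i = subst (_∈ 𝒮₂) (sym (alt-agree-above hi C₂-≥hi i hi<i))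
                            (keeps _ (grows₁ _ (above-seen i hi<i i<m)))

        ready-left : Ready C₂ 𝒮₂ lo mid
        ready-left = record
          { sat        = sat-left
          ; only-chain = only-chain-left
          ; chain-seen = λ k lo<k k≤mid → moved-seen k lo<k (≤-<-trans k≤mid mid<hi)
          ; hi≤m       = <⇒≤ (<-≤-trans mid<hi hi≤m)
          ; edge-seen  = edge-seen-left
          ; above-seen = above-seen-left
          }

      open AfterShift public using (ready-left)

      module AfterRight {G₃ : List ℕ} (right : Explored C₂ 𝒮₂ lo mid G₃) where
        open AfterShift
        open Explored right
          renaming (chain to S₃; seen to 𝒮₃; run to run₃; fixed to fixed₃; sat′ to sat₃;
                    complete to complete₃; grows to grows₃; confined to confined₃)

        fixed-all : ∀ i → i ≤ lo ⊎ hi ≤ i → S₃ i ≡ S i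
        fixed-all i (inj₁ i≤lo) = trans (fixed₃ i (inj₁ i≤lo))
                                    (trans (unmoved i (inj₁ i≤lo)) (fixed₁ i (inj₁ (m≤n⇒m≤1+n i≤lo))))
        fixed-all i (inj₂ hi≤i) = trans (fixed₃ i (inj₂ (≤-trans (<⇒≤ mid<hi) hi≤i))) (C₂-≥hi i hi≤i)

        -- The last step of the final chain, from S hi ─ ⁅ w ⁆ to S hi, adds w.
        sat-all : Saturated S₃ lo hi
        sat-all i lo≤i i<hi with m≤n⇒m<n∨m≡n (<hi⇒≤mid i<hi)
        ... | inj₁ i<mid = sat₃ i lo≤i i<mid
        ... | inj₂ refl  = w , (λ w∈ → w∉C₂-mid (⊆-reflexive S₃-mid w∈)) , top
          where
          S₃-mid : S₃ mid ≡ C₂ mid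
          S₃-mid = fixed₃ mid (inj₂ ≤-refl)
          top : S₃ (suc mid) ≡ S₃ mid ∪ ⁅ w ⁆
          top = begin
            S₃ (suc mid)             ≡⟨ fixed₃ (suc mid) (inj₂ (n≤1+n mid)) ⟩
            C₂ (suc mid)             ≡⟨ C₂-mid+1 ⟩
            S hi                     ≡⟨ remove-add w∈S-hi ⟨
            (S hi ─ ⁅ w ⁆) ∪ ⁅ w ⁆   ≡⟨ cong (_∪ ⁅ w ⁆) (trans S₃-mid C₂-mid) ⟨
            S₃ mid ∪ ⁅ w ⁆           ∎
            where open ≡-Reasoning

        -- Sets without w were explored in phase 3, sets with w in phase 1 (or, for S (lo+1), before).
        complete-all : ∀ X → S lo ⊂ X → X ⊆ S hi → X ∈ 𝒮₃
        complete-all X S-lo⊂X X⊆S-hi with w ∈ˢ? X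
        ... | no w∉X = complete₃ X (subst (_⊂ X) (sym C₂-lo) S-lo⊂X)
                         (⊆-trans (⊆-─⁅⁆ X⊆S-hi w∉X) (⊆-reflexive (sym C₂-mid)))
        ... | yes w∈X with escapes-or-⊆ X (S (suc lo))
        ...   | inj₁ (y , y∈X , y∉) =
                grows₃ _ (keeps _ (complete₁ X (S-lo+1⊆ (proj₁ S-lo⊂X) w∈X , y , y∈X , y∉) X⊆S-hi))
        ...   | inj₂ X⊆S-lo+1 =
                grows₃ _ (keeps _ (grows₁ _ (subst (_∈ 𝒮) (⊆-antisym (S-lo+1⊆ (proj₁ S-lo⊂X) w∈X) X⊆S-lo+1)
                                                     S-lo+1-seen)))

        confined-all : ∀ X → X ∈ 𝒮₃ → X ∈ 𝒮 ⊎ (S lo ⊂ X × X ⊆ S hi)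
        confined-all X X∈ with confined₃ X X∈
        ... | inj₂ (C₂-lo⊂X , X⊆C₂-mid) = inj₂ (subst (_⊂ X) C₂-lo C₂-lo⊂X , ⊆-trans X⊆C₂-mid C₂-mid⊆S-hi)
        ... | inj₁ X∈𝒮₂ with origin X X∈𝒮₂
        ...   | inj₂ (i , lo<i , i<hi , X≡C₂i) =
                inj₂ ( subst₂ _⊂_ C₂-lo (sym X≡C₂i) (saturated-strict sat-left lo<i (<hi⇒≤mid i<hi))
                     , ⊆-trans (⊆-reflexive X≡C₂i)
                         (⊆-trans (saturated-mono sat-left (<⇒≤ lo<i) (<hi⇒≤mid i<hi) ≤-refl) C₂-mid⊆S-hi) )
        ...   | inj₁ X∈𝒮₁ with confined₁ X X∈𝒮₁
        ...     | inj₁ X∈𝒮 = inj₁ X∈𝒮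
        ...     | inj₂ (S-lo+1⊂X , X⊆S-hi) = inj₂ (⊆-⊂-trans (cover⊆ S-lo+1) S-lo+1⊂X , X⊆S-hi)

        explored : Explored S 𝒮 lo hi (G₁ ++ from (suc lo) n ++ G₃)
        explored = record
          { chain    = S₃
          ; seen     = 𝒮₃
          ; run      = steps-++ run₁ (steps-++ steps₂ run₃)
          ; fixed    = fixed-all
          ; sat′     = sat-all
          ; complete = complete-all
          ; grows    = λ X X∈ → grows₃ X (keeps X (grows₁ X X∈))
          ; confined = confined-all
          }

  explore : ∀ n lo hi → lo + n ≡ hi → ∀ S 𝒮 → Ready S 𝒮 lo hi → Explored S 𝒮 lo hi (map (lo +_) (R n))
  explore zero lo hi lo+0≡hi S 𝒮 ready = record
    { chain    = S
    ; seen     = 𝒮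
    ; run      = done
    ; fixed    = λ _ _ → refl
    ; sat′     = Ready.sat ready
    ; complete = λ { X (_ , x , x∈X , x∉S-lo) X⊆S-hi →
                     ⊥-elim (x∉S-lo (subst (λ k → x ∈ˢ S k) (sym lo≡hi) (X⊆S-hi x∈X))) }
    ; grows    = λ _ X∈ → X∈
    ; confined = λ _ X∈ → inj₁ X∈
    }
    where
    lo≡hi : lo ≡ hi
    lo≡hi = trans (sym (+-identityʳ lo)) lo+0≡hi
  explore (suc n) lo hi e S 𝒮 ready = subst (Explored S 𝒮 lo hi) (sym (R-shift lo n)) explored
    where
    open InductiveStep n lo hi e S 𝒮 ready
    open AfterLeft (explore n (suc lo) hi mid+1≡hi S 𝒮 ready-right)
    open AfterRight (explore n lo mid refl C₂ 𝒮₂ ready-left)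

  -- At the start, no alteration of a saturated chain [0, m] has been seen, so J = {1,…,m-1}.
  fresh-start : ∀ {S 𝒮} → Ready S 𝒮 0 m → computeJ m S 𝒮 ≡ indices m
  fresh-start {S} {𝒮} ready = filter-all _ {indices m} (All.tabulate λ i∈ → unseen _ (∈-indices⁻ {m} i∈))
    where
    open Ready ready
    unseen : ∀ i → 1 ≤ i × i < m → ¬ (alt S i ∈ 𝒮)
    unseen i (1≤i , i<m) alt∈ =
      let (S₀⊂alt , alt⊆Sm) = alt-between i sat 1≤i i<m
          (k , _ , k≤m , alt≡Sk) = only-chain _ S₀⊂alt alt⊆Sm alt∈
      in alt-off-chain i sat 1≤i i<m k z≤n k≤m alt≡Sk

  -- After exploring the whole window [0, m] every alteration has been seen, so J = [].
  explored-stops : ∀ {S 𝒮 G} (ex : Explored S 𝒮 0 m G) → computeJ m (Explored.chain ex) (Explored.seen ex) ≡ []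
  explored-stops {S} ex = computeJ-empty chain seen λ i 1≤i i<m →
    let (S₀⊂alt , alt⊆Sm) = alt-between i sat′ 1≤i i<m in
    complete _ (subst (_⊂ alt chain i) (fixed 0 (inj₁ z≤n)) S₀⊂alt)
               (⊆-trans alt⊆Sm (⊆-reflexive (fixed m (inj₂ ≤-refl))))
    where open Explored ex

  ∈-initChain⁻ : ∀ {x : Fin m} {i} → x ∈ˢ initChain m i → toℕ x < i
  ∈-initChain⁻ {x} {i} x∈ = <ᵇ⇒< (toℕ x) i
    (subst T (trans (sym ([]=⇒lookup x∈)) (lookup∘tabulate (λ y → toℕ y <ᵇ i) x)) tt)

  ∈-initChain⁺ : ∀ {x : Fin m} {i} → toℕ x < i → x ∈ˢ initChain m i
  ∈-initChain⁺ {x} {i} x<i = lookup⇒[]= x (initChain m i)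
    (trans (lookup∘tabulate (λ y → toℕ y <ᵇ i) x) (T⇒≡true (<⇒<ᵇ x<i)))
    where
    T⇒≡true : ∀ {b} → T b → b ≡ true
    T⇒≡true {true} _ = refl

  -- Step i of the initial chain adds the element with index i.
  initChain-saturated : Saturated (initChain m) 0 m
  initChain-saturated i _ i<m = z , (λ z∈ → n≮n i (subst (_< i) toℕ-z (∈-initChain⁻ z∈))) , ⊆-antisym ⊆-part ⊇-part
    where
    z : Fin m
    z = fromℕ< i<m
    toℕ-z : toℕ z ≡ i
    toℕ-z = toℕ-fromℕ< i<m
    ⊆-part : initChain m (suc i) ⊆ initChain m i ∪ ⁅ z ⁆
    ⊆-part {x} x∈ with m≤n⇒m<n∨m≡n (≤-pred (∈-initChain⁻ x∈))
    ... | inj₁ x<i = p⊆p∪q ⁅ z ⁆ (∈-initChain⁺ x<i)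
    ... | inj₂ x≡i = q⊆p∪q (initChain m i) ⁅ z ⁆
                       (subst (_∈ˢ ⁅ z ⁆) (sym (toℕ-injective (trans x≡i (sym toℕ-z)))) (x∈⁅x⁆ z))
    ⊇-part : initChain m i ∪ ⁅ z ⁆ ⊆ initChain m (suc i)
    ⊇-part x∈ with x∈p∪q⁻ (initChain m i) ⁅ z ⁆ x∈
    ... | inj₁ x∈Sᵢ = ∈-initChain⁺ (m≤n⇒m≤1+n (∈-initChain⁻ x∈Sᵢ))
    ... | inj₂ x∈z  = ∈-initChain⁺ (subst (_< suc i) (sym (trans (cong toℕ (x∈⁅y⁆⇒x≡y z x∈z)) toℕ-z)) (n<1+n i))

  initial-ready : Ready (initChain m) (map (initChain m) (from 1 m)) 0 m
  initial-ready = record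
    { sat        = initChain-saturated
    ; only-chain = only-chain₀
    ; chain-seen = chain-seen₀
    ; hi≤m       = ≤-refl
    ; edge-seen  = λ m<m → ⊥-elim (n≮n m m<m)
    ; above-seen = λ i m<i i<m → ⊥-elim (n≮n m (<-trans m<i i<m))
    }
    where
    only-chain₀ : ∀ X → initChain m 0 ⊂ X → X ⊆ initChain m m → X ∈ map (initChain m) (from 1 m) →
                  Σ ℕ λ k → 0 < k × k ≤ m × X ≡ initChain m k
    only-chain₀ X _ _ X∈ with ∈-map⁻ (initChain m) X∈
    ... | k , k∈ , X≡Sk with ∈-applyUpTo⁻ (1 +_) k∈
    ...   | i , i<m , refl = suc i , s≤s z≤n , i<m , X≡Sk
    chain-seen₀ : ∀ k → 0 < k → k ≤ m → initChain m k ∈ map (initChain m) (from 1 m)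
    chain-seen₀ (suc i) _ i<m = ∈-map⁺ (initChain m) (∈-applyUpTo⁺ (1 +_) i<m)

-- Theorem 3.1: the greedy procedure returns Rₘ.
theorem3p1 : (m : ℕ) → 2 ≤ m → GreedyReturns m (R m)
theorem3p1 m _ =
  subst₂ (GreedyRun m (initChain m) 𝒮₀) (fresh-start {m} initial-ready) (map-id (R m))
         (steps⇒run run (explored-stops whole))
  where
  𝒮₀ : List (Subset m)
  𝒮₀ = map (initChain m) (from 1 m)
  whole : Explored (initChain m) 𝒮₀ 0 m (map (0 +_) (R m))
  whole = explore m 0 m refl (initChain m) 𝒮₀ initial-ready
  open Explored whole using (run)
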